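{- The inference relation is sound: ${\vdash}\subseteq{\vDash}$, i.e. for every set of statements $\Gamma$ and every statement $X$, if $\Gamma\vdash X$ then $\Gamma\vDash X$.
   Context: Set-theoretic conventions: for sets $R,s$, $\mathrm{dom}(R)=\{d\mid\exists r\,\langle r,d\rangle\in R\}$, $R(s)=\bigcup\{r\mid\langle r,s\rangle\in R\}$; functions are sets of pairs $\langle F(d),d\rangle$; for a function $F$ with domain $X$, $\prod F$ is the set of functions $f$ on $X$ with $f(x)\in F(x)$. Terms: constants $\mathsf{C}=\{\mathsf{c},\mathsf{c}',\dots\}$, variables $\mathsf{V}=\{\mathsf{v},\mathsf{v}',\dots\}$; $\mathsf{T}$ is the smallest set of strings containing $\mathsf{C}\cup\mathsf{V}$ and $\rho S$, $\beta RS$, $\lambda xRS$ for $R,S\in\mathsf{T}$, $x\in\mathsf{V}$; write $FS$ for $\beta FS$ and $\pi xPR$ for $\rho\lambda xPR$. Free variables: $\mathsf{F}(a)=\emptyset$ for constants, $\mathsf{F}(x)=\{x\}$, $\mathsf{F}(\rho R)=\mathsf{F}(R)$, $\mathsf{F}(\beta RS)=\mathsf{F}(R)\cup\mathsf{F}(S)$, $\mathsf{F}(\lambda xRS)=\mathsf{F}(R)\cup(\mathsf{F}(S)\setminus\{x\})$. Substitution: for $t\in\mathsf{C}\cup\mathsf{V}$, $t_{[T/x]}=T$ if $t=x$, else $t$; $(\rho R)_{[T/x]}=\rho R_{[T/x]}$; $(\beta RS)_{[T/x]}=\beta R_{[T/x]}S_{[T/x]}$; $(\lambda yRS)_{[T/x]}=\lambda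 yR_{[T/x]}S$ if $y=x$ or $x\notin\mathsf{F}(S)$, otherwise $\lambda zR_{[T/x]}S_{[z/y][T/x]}$ with $z\notin\mathsf{F}(T)\cup(\mathsf{F}(S)\setminus\{y\})$ and $z=y$ whenever $y\notin\mathsf{F}(T)$. Interpretations: an assignment (function $\mathsf{C}\cup\mathsf{V}\to$ sets) extends uniquely to $\llbracket\cdot\rrbracket$ on $\mathsf{T}$ with $\llbracket\rho S\rrbracket=\prod\llbracket S\rrbracket$, $\llbracket\beta RS\rrbracket=\llbracket R\rrbracket(\llbracket S\rrbracket)$, $\llbracket\lambda xRS\rrbracket=\{\langle\llbracket S\rrbracket_{\langle r,x\rangle},r\rangle\mid r\in\llbracket R\rrbracket\}$ ($\llbracket\cdot\rrbracket_{\langle s,x\rangle}$ = assignment modified to value $s$ at $x$). $\alpha$-equivalence: bound variables $\mathsf{B}(T)=\{x\in\mathsf{V}\mid\lambda x\text{ is a substring of }T\}$, $\mathsf{V}(T)=\mathsf{F}(T)\cup\mathsf{B}(T)$; $\equiv_\alpha$ is the reflexive transitive closure of the relation replacing one subterm occurrence $\lambda xRS$ by $\lambda yRS_{[y/x]}$ where $x\notin\mathsf{B}(S)$, $y\notin\mathsf{V}(S)$; it is an equivalence relation and $\alpha$-equivalent terms have equal interpretations. Statements: $(S:P)$ is the pair of $\equiv_\alpha$-classes of $S,P$; an interpretation satisfies $(S:P)$ iff $\llbracket S\rrbracket\in\llbracket P\rrbracket$; $\Gamma\vDash X$ means every interpretation satisfying all of $\Gamma$ satisfies $X$. $\mathsf{F}(\Gamma)=\bigcup_{(S:P)\in\Gamma}(\mathsf{F}(S)\cup\mathsf{F}(P))$.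 For a relation $\Vdash$ between sets of statements and statements, $\Gamma\Vdash\Delta$ means $\Gamma\Vdash X$ for all $X\in\Delta$; $\Vdash$ is a sequent if $X\in\Gamma$ implies $\Gamma\Vdash X$ and $\Gamma\Vdash\Delta\Vdash X$ implies $\Gamma\Vdash X$. The inference relation $\vdash$ is the smallest sequent such that for all sets $\Gamma$ of statements, $F,P,Q,R,S\in\mathsf{T}$ and $x\in\mathsf{V}\setminus(\mathsf{F}(\Gamma)\cup\mathsf{F}(Q))$: $\{(F:\pi xPR),(S:P)\}\vdash(FS:R_{[S/x]})$, and if $\Gamma\cup\{(x:Q)\}\vdash(S:P)$ then $\Gamma\vdash(\lambda xQS:\pi xQP)$. -}

module Defs where

open import Data.Nat using (ℕ; zero; suc; _≡ᵇ_; _⊔_)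
open import Data.Bool using (Bool; true; false; if_then_else_; _∨_; _∧_; not)
open import Data.Product using (Σ; _×_; _,_; proj₁; proj₂)
open import Data.Sum using (_⊎_)
open import Data.Empty using (⊥)
open import Relation.Binary.PropositionalEquality using (_≡_)
open import Relation.Binary.Construct.Closure.ReflexiveTransitive using (Star)

data Term : Set where
  con : ℕ → Term
  var : ℕ → Term
  ρ   : Term → Term
  β   : Term → Term → Term
  ƛ   : ℕ → Term → Term → Term

π : ℕ → Term → Term → Term
π x P R = ρ (ƛ x P R)

free : ℕ → Term → Bool
free x (con _)   = false
free x (var y)   = x ≡ᵇ y
free x (ρ R)     = free x R
free x (β R S)   = free x R ∨ free x S
free x (ƛ y R S) = free x R ∨ (free x S ∧ not (x ≡ᵇ y))

bound : ℕ → Term → Bool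
bound x (con _)   = false
bound x (var _)   = false
bound x (ρ R)     = bound x R
bound x (β R S)   = bound x R ∨ bound x S
bound x (ƛ y R S) = (x ≡ᵇ y) ∨ bound x R ∨ bound x S

_∈F_ : ℕ → Term → Set
x ∈F T = free x T ≡ true

_∉F_ : ℕ → Term → Set
x ∉F T = free x T ≡ false

_∉B_ : ℕ → Term → Set
x ∉B T = bound x T ≡ false

_∉V_ : ℕ → Term → Set
x ∉V T = (free x T ∨ bound x T) ≡ false

maxVar : Term → ℕ
maxVar (con _)   = 0
maxVar (var y)   = y
maxVar (ρ R)     = maxVar R
maxVar (β R S)   = maxVar R ⊔ maxVar S
maxVar (ƛ y R S) = y ⊔ maxVar R ⊔ maxVar S

-- a variable not in V(T) ∪ V(S)  (hence not in F(T) ∪ (F(S) ∖ {y}))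
fresh : Term → Term → ℕ
fresh T S = suc (maxVar T ⊔ maxVar S)

size : Term → ℕ
size (con _)   = 1
size (var _)   = 1
size (ρ R)     = suc (size R)
size (β R S)   = suc (size R ⊔ size S)
size (ƛ _ R S) = suc (size R ⊔ size S)

-- fuel-bounded version of the clauses of the paper; the fuel (first
-- argument) is always at least the size of the term being substituted
-- into (renaming a variable does not change size), so the dummy
-- zero-fuel clause is never reached from  _[_/_]  below.
sub : ℕ → Term → ℕ → Term → Term
sub zero    T x R         = R
sub (suc n) T x (con a)   = con a
sub (suc n) T x (var y)   = if x ≡ᵇ y then T else var y
sub (suc n) T x (ρ R)     = ρ (sub n T x R)
sub (suc n) T x (β R S)   = β (sub n T x R) (sub n T x S)
sub (suc n) T x (ƛ y R S) =
  if (y ≡ᵇ x) ∨ not (free x S)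
  then ƛ y (sub n T x R) S
  else ƛ z (sub n T x R) (sub n T x (sub n (var z) y S))
  where
  -- z ∉ F(T) ∪ (F(S) ∖ {y}), and z = y whenever y ∉ F(T)
  z : ℕ
  z = if free y T then fresh T S else y

_[_/_] : Term → Term → ℕ → Term
R [ T / x ] = sub (size R) T x R

data α-step : Term → Term → Set where
  rename : ∀ x y R S → x ∉B S → y ∉V S →
           α-step (ƛ x R S) (ƛ y R (S [ var y / x ]))
  ρ-cong  : ∀ {R R'} → α-step R R' → α-step (ρ R) (ρ R')
  βˡ-cong : ∀ {R R' S} → α-step R R' → α-step (β R S) (β R' S)
  βʳ-cong : ∀ {R S S'} → α-step S S' → α-step (β R S) (β R S')
  ƛˡ-cong : ∀ {x R R' S} → α-step R R' → α-step (ƛ x R S) (ƛ x R' S)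
  ƛʳ-cong : ∀ {x R S S'} → α-step S S' → α-step (ƛ x R S) (ƛ x R S')

_≡α_ : Term → Term → Set
_≡α_ = Star α-step

-- A statement (S : P) is represented by a pair of representatives;
-- a set of statements by a predicate on such pairs, standing for the
-- set of ≡α-classes of the pairs satisfying it.

Stmt : Set
Stmt = Term × Term

StmtSet : Set₁
StmtSet = Stmt → Set

_∈Γ_ : Stmt → StmtSet → Set
X ∈Γ Γ = Σ Stmt λ Y → Γ Y × (proj₁ X ≡α proj₁ Y) × (proj₂ X ≡α proj₂ Y)

_∪｛_｝ : StmtSet → Stmt → StmtSet
(Γ ∪｛ X ｝) Y = Γ Y ⊎ Y ≡ X

｛_,_｝ : Stmt → Stmt → StmtSet
｛ X , X' ｝ Y = Y ≡ X ⊎ Y ≡ X'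

_∉FΓ_ : ℕ → StmtSet → Set
x ∉FΓ Γ = ∀ Y → Γ Y → x ∉F proj₁ Y × x ∉F proj₂ Y

infix 4 _⊢_
data _⊢_ : StmtSet → Stmt → Set₁ where
  hyp : ∀ {Γ X} → X ∈Γ Γ → Γ ⊢ X
  cut : ∀ {Γ X} (Δ : StmtSet) → (∀ Y → Δ Y → Γ ⊢ Y) → Δ ⊢ X → Γ ⊢ X
  app : ∀ F x P R S →
        ｛ (F , π x P R) , (S , P) ｝ ⊢ (β F S , R [ S / x ])
  lam : ∀ {Γ} x Q S P → x ∉FΓ Γ → x ∉F Q →
        (Γ ∪｛ (var x , Q) ｝) ⊢ (S , P) →
        Γ ⊢ (ƛ x Q S , π x Q P)

record ZF : Set₁ where
  infix 4 _∈_
  field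
    V   : Set
    _∈_ : V → V → Set
    extensionality : ∀ a b → (∀ z → (z ∈ a → z ∈ b) × (z ∈ b → z ∈ a)) → a ≡ b
    ∅   : V
    ∅-spec : ∀ z → z ∈ ∅ → ⊥
    pair : V → V → V
    pair-spec : ∀ a b z → (z ∈ pair a b → z ≡ a ⊎ z ≡ b) × (z ≡ a ⊎ z ≡ b → z ∈ pair a b)
    ⋃   : V → V
    ⋃-spec : ∀ a z → (z ∈ ⋃ a → Σ V λ w → z ∈ w × w ∈ a) × (Σ V (λ w → z ∈ w × w ∈ a) → z ∈ ⋃ a)
    𝒫   : V → V
    𝒫-spec : ∀ a z → (z ∈ 𝒫 a → ∀ w → w ∈ z → w ∈ a) × ((∀ w → w ∈ z → w ∈ a) → z ∈ 𝒫 a)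
    sep : (V → Set) → V → V
    sep-spec : ∀ P a z → (z ∈ sep P a → z ∈ a × P z) × (z ∈ a × P z → z ∈ sep P a)
    repl : (V → V) → V → V
    repl-spec : ∀ f a z → (z ∈ repl f a → Σ V λ x → x ∈ a × z ≡ f x) × (Σ V (λ x → x ∈ a × z ≡ f x) → z ∈ repl f a)
    ω   : V
    ω-zero : ∅ ∈ ω
    ω-suc  : ∀ x → x ∈ ω → ⋃ (pair x (pair x x)) ∈ ω
    ∈-induction : (P : V → Set) → (∀ a → (∀ b → b ∈ a → P b) → P a) → ∀ a → P a

module Semantics (M : ZF) where
  open ZF M

  ⟨_,_⟩ : V → V → V
  ⟨ a , b ⟩ = pair (pair a a) (pair a b)

  _∪_ : V → V → V
  a ∪ b = ⋃ (pair a b)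

  dom : V → V
  dom R = sep (λ d → Σ V λ r → ⟨ r , d ⟩ ∈ R) (⋃ (⋃ R))

  _﹫_ : V → V → V
  R ﹫ s = ⋃ (sep (λ r → ⟨ r , s ⟩ ∈ R) (⋃ (⋃ R)))

  IsFunctionOn : V → V → Set
  IsFunctionOn f X =
    (∀ z → z ∈ f → Σ V λ y → Σ V λ d → z ≡ ⟨ y , d ⟩ × d ∈ X) ×
    (∀ d → d ∈ X → Σ V λ y → ⟨ y , d ⟩ ∈ f) ×
    (∀ d y y' → ⟨ y , d ⟩ ∈ f → ⟨ y' , d ⟩ ∈ f → y ≡ y')

  -- ∏F = the set of functions f on dom(F) with f(x) ∈ F(x);
  -- every such f is a subset of 𝒫𝒫(⋃⋃F ∪ ⋃⋃⋃F), which bounds it.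
  ∏ : V → V
  ∏ F = sep (λ f → IsFunctionOn f (dom F) × (∀ d → d ∈ dom F → (f ﹫ d) ∈ (F ﹫ d)))
            (𝒫 (𝒫 (𝒫 (⋃ (⋃ F) ∪ ⋃ (⋃ (⋃ F))))))

  Assignment : Set
  Assignment = (ℕ → V) × (ℕ → V)

  _[_≔_] : Assignment → ℕ → V → Assignment
  (c , v) [ x ≔ s ] = c , λ y → if y ≡ᵇ x then s else v y

  ⟦_⟧ : Term → Assignment → V
  ⟦ con a ⟧   ν = proj₁ ν a
  ⟦ var x ⟧   ν = proj₂ ν x
  ⟦ ρ S ⟧     ν = ∏ (⟦ S ⟧ ν)
  ⟦ β R S ⟧   ν = ⟦ R ⟧ ν ﹫ ⟦ S ⟧ ν
  ⟦ ƛ x R S ⟧ ν = repl (λ r → ⟨ ⟦ S ⟧ (ν [ x ≔ r ]) , r ⟩) (⟦ R ⟧ ν)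

  Satisfies : Assignment → Stmt → Set
  Satisfies ν (S , P) = ⟦ S ⟧ ν ∈ ⟦ P ⟧ ν

  infix 4 _⊨_
  _⊨_ : StmtSet → Stmt → Set
  Γ ⊨ X = ∀ (ν : Assignment) → (∀ Y → Γ Y → Satisfies ν Y) → Satisfies ν X

{-# OPTIONS --safe #-}
-- A term λxRS denotes the graph {⟨⟦S⟧ν[x≔r], r⟩ | r ∈ ⟦R⟧ν}, and ∏ of such a graph
-- is exactly the set of functions f on ⟦R⟧ν with f(r) ∈ ⟦S⟧ν[x≔r]. So the
-- application rule is evaluation of such an f, and the abstraction rule builds
-- a graph inside the product. What remains is the substitution lemma
-- ⟦R[T/x]⟧ν = ⟦R⟧ν[x≔⟦T⟧ν]: it holds because a binder is renamed whenever it
-- would capture a free variable of T. α-steps are instances of it, and the side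
-- condition x ∉ F(Γ) ∪ F(Q) makes the hypotheses insensitive to the value of x.
module Submission where

open import Defs
open import Data.Nat using (ℕ; zero; suc; _≡ᵇ_; _⊔_; _≤_; _<_; s≤s)
open import Data.Nat.Properties
  using (_≟_; ≤-refl; ≤-trans; <-≤-trans; <-irrefl; m≤m⊔n; m≤n⊔m; m⊔n≤o⇒m≤o; m⊔n≤o⇒n≤o)
open import Data.Bool using (true; false; _∨_; not)
open import Data.Bool.Properties using (∨-zeroʳ; ∨-conicalˡ; ∧-conicalˡ)
open import Data.Product using (Σ; _×_; _,_; proj₁; proj₂)
open import Data.Sum using (_⊎_; inj₁; inj₂; [_,_]; reduce)
open import Data.Empty using (⊥-elim)
open import Function using (_∘_; case_of_)
open import Relation.Nullary using (proof)
open import Relation.Nullary.Reflects using (Reflects; ofʸ; ofⁿ)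
open import Relation.Binary.PropositionalEquality
  using (_≡_; _≢_; refl; sym; trans; cong; cong₂; subst; subst₂; module ≡-Reasoning)
open import Relation.Binary.Construct.Closure.ReflexiveTransitive using (ε; _◅_)

≡ᵇ-reflects : ∀ m n → Reflects (m ≡ n) (m ≡ᵇ n)
≡ᵇ-reflects m n = proof (m ≟ n)

≡ᵇ-refl : ∀ m → (m ≡ᵇ m) ≡ true
≡ᵇ-refl m with m ≡ᵇ m | ≡ᵇ-reflects m m
... | true  | _       = refl
... | false | ofⁿ m≢m = ⊥-elim (m≢m refl)

≢⇒≡ᵇ-false : ∀ {m n} → m ≢ n → (m ≡ᵇ n) ≡ false
≢⇒≡ᵇ-false {m} {n} m≢n with m ≡ᵇ n | ≡ᵇ-reflects m n
... | true  | ofʸ m≡n = ⊥-elim (m≢n m≡n)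
... | false | _       = refl

∨-≡-true⁻ : ∀ a {b} → (a ∨ b) ≡ true → a ≡ true ⊎ b ≡ true
∨-≡-true⁻ true  _ = inj₁ refl
∨-≡-true⁻ false p = inj₂ p

∈F-var : ∀ x → x ∈F var x
∈F-var = ≡ᵇ-refl

∈F-βˡ : ∀ {w} R S → w ∈F R → w ∈F β R S
∈F-βˡ R S w∈R = cong (_∨ _) w∈R

∈F-βʳ : ∀ {w} R S → w ∈F S → w ∈F β R S
∈F-βʳ {w} R S w∈S = trans (cong (free w R ∨_) w∈S) (∨-zeroʳ (free w R))

∈F-ƛˡ : ∀ {w} y R S → w ∈F R → w ∈F ƛ y R S
∈F-ƛˡ y R S w∈R = cong (_∨ _) w∈R

∈F-ƛʳ : ∀ {w} y R S → w ∈F S → w ≢ y → w ∈F ƛ y R S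
∈F-ƛʳ {w} y R S w∈S w≢y rewrite w∈S | ≢⇒≡ᵇ-false w≢y = ∨-zeroʳ (free w R)

∈F-∉F-≢ : ∀ {w x} T → w ∈F T → x ∉F T → w ≢ x
∈F-∉F-≢ T w∈T x∉T refl with () ← trans (sym w∈T) x∉T

∈F⇒≤maxVar : ∀ {w} T → w ∈F T → w ≤ maxVar T
∈F⇒≤maxVar (con _) ()
∈F⇒≤maxVar {w} (var y) w∈T with w ≡ᵇ y | ≡ᵇ-reflects w y
... | true | ofʸ refl = ≤-refl
∈F⇒≤maxVar (ρ R) w∈T = ∈F⇒≤maxVar R w∈T
∈F⇒≤maxVar {w} (β R S) w∈T with ∨-≡-true⁻ (free w R) w∈T
... | inj₁ w∈R = ≤-trans (∈F⇒≤maxVar R w∈R) (m≤m⊔n _ _)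
... | inj₂ w∈S = ≤-trans (∈F⇒≤maxVar S w∈S) (m≤n⊔m _ _)
∈F⇒≤maxVar {w} (ƛ y R S) w∈T with ∨-≡-true⁻ (free w R) w∈T
... | inj₁ w∈R = ≤-trans (∈F⇒≤maxVar R w∈R) (≤-trans (m≤n⊔m y _) (m≤m⊔n _ _))
... | inj₂ w∈S∖y = ≤-trans (∈F⇒≤maxVar S (∧-conicalˡ _ _ w∈S∖y)) (m≤n⊔m _ _)

maxVar<⇒∉F : ∀ {w} T → maxVar T < w → w ∉F T
maxVar<⇒∉F {w} T max<w with free w T in w∈T
... | false = refl
... | true  = ⊥-elim (<-irrefl refl (<-≤-trans max<w (∈F⇒≤maxVar T w∈T)))

fresh-∉Fˡ : ∀ T S → fresh T S ∉F T
fresh-∉Fˡ T S = maxVar<⇒∉F T (s≤s (m≤m⊔n _ _))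

fresh-∉Fʳ : ∀ T S → fresh T S ∉F S
fresh-∉Fʳ T S = maxVar<⇒∉F S (s≤s (m≤n⊔m _ _))

size-sub-var : ∀ n z y S → size (sub n (var z) y S) ≡ size S
size-sub-var zero    z y S         = refl
size-sub-var (suc n) z y (con _)   = refl
size-sub-var (suc n) z y (var w) with y ≡ᵇ w
... | true  = refl
... | false = refl
size-sub-var (suc n) z y (ρ R)     = cong suc (size-sub-var n z y R)
size-sub-var (suc n) z y (β R S)   =
  cong₂ (λ a b → suc (a ⊔ b)) (size-sub-var n z y R) (size-sub-var n z y S)
size-sub-var (suc n) z y (ƛ w R S) with (w ≡ᵇ y) ∨ not (free y S)
... | true  = cong (λ a → suc (a ⊔ size S)) (size-sub-var n z y R)
... | false = cong₂ (λ a b → suc (a ⊔ b)) (size-sub-var n z y R)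
                (trans (size-sub-var n z y _) (size-sub-var n _ w S))

module Graphs (M : ZF) where
  open ZF M
  open Semantics M

  ext : ∀ {a b} → (∀ z → z ∈ a → z ∈ b) → (∀ z → z ∈ b → z ∈ a) → a ≡ b
  ext {a} {b} a⊆b b⊆a = extensionality a b (λ z → a⊆b z , b⊆a z)

  ∈-pairˡ : ∀ {a b} → a ∈ pair a b
  ∈-pairˡ = proj₂ (pair-spec _ _ _) (inj₁ refl)

  ∈-pairʳ : ∀ {a b} → b ∈ pair a b
  ∈-pairʳ = proj₂ (pair-spec _ _ _) (inj₂ refl)

  ∈-pair⁻ : ∀ {a b z} → z ∈ pair a b → z ≡ a ⊎ z ≡ b
  ∈-pair⁻ = proj₁ (pair-spec _ _ _)

  ∈-singleton⁻ : ∀ {a z} → z ∈ pair a a → z ≡ a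
  ∈-singleton⁻ z∈a = reduce (∈-pair⁻ z∈a)

  ∈-⋃⁺ : ∀ {a w z} → z ∈ w → w ∈ a → z ∈ ⋃ a
  ∈-⋃⁺ z∈w w∈a = proj₂ (⋃-spec _ _) (_ , z∈w , w∈a)

  ∈-∪ˡ : ∀ {a b z} → z ∈ a → z ∈ (a ∪ b)
  ∈-∪ˡ z∈a = ∈-⋃⁺ z∈a ∈-pairˡ

  ∈-∪ʳ : ∀ {a b z} → z ∈ b → z ∈ (a ∪ b)
  ∈-∪ʳ z∈b = ∈-⋃⁺ z∈b ∈-pairʳ

  ∈-𝒫⁺ : ∀ {a z} → (∀ w → w ∈ z → w ∈ a) → z ∈ 𝒫 a
  ∈-𝒫⁺ = proj₂ (𝒫-spec _ _)

  pair-∈-𝒫 : ∀ {a b B} → a ∈ B → b ∈ B → pair a b ∈ 𝒫 B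
  pair-∈-𝒫 a∈B b∈B =
    ∈-𝒫⁺ λ w w∈ab → [ (λ { refl → a∈B }) , (λ { refl → b∈B }) ] (∈-pair⁻ w∈ab)

  ⟨,⟩-∈-𝒫𝒫 : ∀ {a b B} → a ∈ B → b ∈ B → ⟨ a , b ⟩ ∈ 𝒫 (𝒫 B)
  ⟨,⟩-∈-𝒫𝒫 a∈B b∈B = pair-∈-𝒫 (pair-∈-𝒫 a∈B a∈B) (pair-∈-𝒫 a∈B b∈B)

  ⟨,⟩-injectiveˡ : ∀ {a b c d} → ⟨ a , b ⟩ ≡ ⟨ c , d ⟩ → a ≡ c
  ⟨,⟩-injectiveˡ {a} {c = c} eq = sym (∈-singleton⁻ c∈｛a｝)
    where
    c∈｛a｝ : c ∈ pair a a
    c∈｛a｝ = [ (λ e → subst (c ∈_) (sym e) ∈-pairˡ) , (λ e → subst (c ∈_) (sym e) ∈-pairˡ) ]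
              (∈-pair⁻ (subst (pair a a ∈_) eq ∈-pairˡ))

  ⟨,⟩-second : ∀ {a b d} → ⟨ a , b ⟩ ≡ ⟨ a , d ⟩ → b ≡ a ⊎ b ≡ d
  ⟨,⟩-second {a} {b} eq with ∈-pair⁻ (subst (pair a b ∈_) eq ∈-pairʳ)
  ... | inj₁ ｛a,b｝≡｛a｝   = inj₁ (∈-singleton⁻ (subst (b ∈_) ｛a,b｝≡｛a｝ ∈-pairʳ))
  ... | inj₂ ｛a,b｝≡｛a,d｝ = ∈-pair⁻ (subst (b ∈_) ｛a,b｝≡｛a,d｝ ∈-pairʳ)

  ⟨,⟩-injectiveʳ : ∀ {a b c d} → ⟨ a , b ⟩ ≡ ⟨ c , d ⟩ → b ≡ d
  ⟨,⟩-injectiveʳ eq with refl ← ⟨,⟩-injectiveˡ eq with ⟨,⟩-second eq | ⟨,⟩-second (sym eq)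
  ... | inj₂ b≡d | _        = b≡d
  ... | inj₁ _   | inj₂ d≡b = sym d≡b
  ... | inj₁ b≡a | inj₁ d≡a = trans b≡a (sym d≡a)

  graph : (V → V) → V → V
  graph h A = repl (λ q → ⟨ h q , q ⟩) A

  ∈-graph⁺ : ∀ {h A q} → q ∈ A → ⟨ h q , q ⟩ ∈ graph h A
  ∈-graph⁺ q∈A = proj₂ (repl-spec _ _ _) (_ , q∈A , refl)

  ∈-graph⁻ : ∀ {h A z} → z ∈ graph h A → Σ V λ q → q ∈ A × z ≡ ⟨ h q , q ⟩
  ∈-graph⁻ = proj₁ (repl-spec _ _ _)

  graph-cong : ∀ {h h' A A'} → A ≡ A' → (∀ q → h q ≡ h' q) → graph h A ≡ graph h' A'
  graph-cong {A' = A'} refl h≗h' = ext (⊆ h≗h') (⊆ (sym ∘ h≗h'))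
    where
    ⊆ : ∀ {f g} → (∀ q → f q ≡ g q) → ∀ z → z ∈ graph f A' → z ∈ graph g A'
    ⊆ {g = g} f≗g z z∈f with q , q∈A , refl ← ∈-graph⁻ z∈f =
      subst (_∈ graph g A') (cong ⟨_, q ⟩ (sym (f≗g q))) (∈-graph⁺ q∈A)

  ⟨,⟩-∈-graph⁻ : ∀ {h A y d} → ⟨ y , d ⟩ ∈ graph h A → d ∈ A × y ≡ h d
  ⟨,⟩-∈-graph⁻ yd∈h with ∈-graph⁻ yd∈h
  ... | q , q∈A , eq with refl ← ⟨,⟩-injectiveʳ eq = q∈A , ⟨,⟩-injectiveˡ eq

  dom-graph : ∀ h A → dom (graph h A) ≡ A
  dom-graph h A = ext dom⊆A A⊆dom
    where
    dom⊆A : ∀ d → d ∈ dom (graph h A) → d ∈ A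
    dom⊆A d d∈dom with _ , yd∈h ← proj₂ (proj₁ (sep-spec _ _ d) d∈dom) = proj₁ (⟨,⟩-∈-graph⁻ yd∈h)
    A⊆dom : ∀ d → d ∈ A → d ∈ dom (graph h A)
    A⊆dom d d∈A = proj₂ (sep-spec _ _ d)
      (∈-⋃⁺ ∈-pairʳ (∈-⋃⁺ ∈-pairʳ (∈-graph⁺ d∈A)) , h d , ∈-graph⁺ d∈A)

  graph-﹫ : ∀ {h A d} → d ∈ A → graph h A ﹫ d ≡ h d
  graph-﹫ {h} {A} {d} d∈A = ext app⊆hd hd⊆app
    where
    app⊆hd : ∀ z → z ∈ graph h A ﹫ d → z ∈ h d
    app⊆hd z z∈app with w , z∈w , w∈sep ← proj₁ (⋃-spec _ z) z∈app
                     with refl ← proj₂ (⟨,⟩-∈-graph⁻ (proj₂ (proj₁ (sep-spec _ _ w) w∈sep))) = z∈w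
    hd⊆app : ∀ z → z ∈ h d → z ∈ graph h A ﹫ d
    hd⊆app z z∈hd = ∈-⋃⁺ z∈hd (proj₂ (sep-spec _ _ _)
      (∈-⋃⁺ ∈-pairˡ (∈-⋃⁺ ∈-pairˡ (∈-graph⁺ d∈A)) , ∈-graph⁺ d∈A))

  graph-isFunctionOn : ∀ h A → IsFunctionOn (graph h A) A
  graph-isFunctionOn h A = pairs , total , functional
    where
    pairs : ∀ z → z ∈ graph h A → Σ V λ y → Σ V λ d → z ≡ ⟨ y , d ⟩ × d ∈ A
    pairs z z∈h with q , q∈A , eq ← ∈-graph⁻ z∈h = h q , q , eq , q∈A
    total : ∀ d → d ∈ A → Σ V λ y → ⟨ y , d ⟩ ∈ graph h A
    total d d∈A = h d , ∈-graph⁺ d∈A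
    functional : ∀ d y y' → ⟨ y , d ⟩ ∈ graph h A → ⟨ y' , d ⟩ ∈ graph h A → y ≡ y'
    functional d y y' yd∈h y'd∈h =
      trans (proj₂ (⟨,⟩-∈-graph⁻ yd∈h)) (sym (proj₂ (⟨,⟩-∈-graph⁻ y'd∈h)))

  ∏-graph-﹫ : ∀ {g A f s} → f ∈ ∏ (graph g A) → s ∈ A → (f ﹫ s) ∈ g s
  ∏-graph-﹫ {g} {A} {f} {s} f∈∏ s∈A = subst ((f ﹫ s) ∈_) (graph-﹫ s∈A)
    (proj₂ (proj₂ (proj₁ (sep-spec _ _ f) f∈∏)) s (subst (s ∈_) (sym (dom-graph g A)) s∈A))

  -- ∏ G is carved out of 𝒫𝒫𝒫 B; a graph over A lies there as soon as A and the
  -- values of h lie in B, which holds for A ⊆ ⋃⋃G and h q ∈ g q ⊆ ⋃⋃⋃G.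
  graph-∈-∏-graph : ∀ {h g A} → (∀ q → q ∈ A → h q ∈ g q) → graph h A ∈ ∏ (graph g A)
  graph-∈-∏-graph {h} {g} {A} h∈g = proj₂ (sep-spec _ _ _) (bounded , isFunction , values)
    where
    G = graph g A
    B = ⋃ (⋃ G) ∪ ⋃ (⋃ (⋃ G))
    bounded : graph h A ∈ 𝒫 (𝒫 (𝒫 B))
    bounded = ∈-𝒫⁺ λ z z∈h → case ∈-graph⁻ z∈h of λ where
      (q , q∈A , refl) → ⟨,⟩-∈-𝒫𝒫
        (∈-∪ʳ (∈-⋃⁺ (h∈g q q∈A) (∈-⋃⁺ ∈-pairˡ (∈-⋃⁺ ∈-pairˡ (∈-graph⁺ q∈A)))))
        (∈-∪ˡ (∈-⋃⁺ ∈-pairʳ (∈-⋃⁺ ∈-pairʳ (∈-graph⁺ q∈A))))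
    isFunction : IsFunctionOn (graph h A) (dom G)
    isFunction = subst (IsFunctionOn (graph h A)) (sym (dom-graph g A)) (graph-isFunctionOn h A)
    values : ∀ d → d ∈ dom G → (graph h A ﹫ d) ∈ (G ﹫ d)
    values d d∈dom = subst₂ _∈_ (sym (graph-﹫ d∈A)) (sym (graph-﹫ d∈A)) (h∈g d d∈A)
      where d∈A = subst (d ∈_) (dom-graph g A) d∈dom

module Soundness (M : ZF) where
  open ZF M
  open Semantics M
  open Graphs M
  open ≡-Reasoning

  update-≡ : ∀ ν x s → proj₂ (ν [ x ≔ s ]) x ≡ s
  update-≡ ν x s rewrite ≡ᵇ-refl x = refl

  update-≢ : ∀ ν {x w} s → w ≢ x → proj₂ (ν [ x ≔ s ]) w ≡ proj₂ ν w
  update-≢ ν s w≢x rewrite ≢⇒≡ᵇ-false w≢x = refl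

  update-agree : ∀ μ μ' x s w → (w ≢ x → proj₂ μ w ≡ proj₂ μ' w) →
                 proj₂ (μ [ x ≔ s ]) w ≡ proj₂ (μ' [ x ≔ s ]) w
  update-agree μ μ' x s w agree with w ≡ᵇ x | ≡ᵇ-reflects w x
  ... | true  | _       = refl
  ... | false | ofⁿ w≢x = agree w≢x

  coincidence : ∀ T {c v v'} → (∀ w → w ∈F T → v w ≡ v' w) → ⟦ T ⟧ (c , v) ≡ ⟦ T ⟧ (c , v')
  coincidence (con a)   v≗v' = refl
  coincidence (var x)   v≗v' = v≗v' x (∈F-var x)
  coincidence (ρ R)     v≗v' = cong ∏ (coincidence R v≗v')
  coincidence (β R S)   v≗v' = cong₂ _﹫_ (coincidence R λ w → v≗v' w ∘ ∈F-βˡ R S)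
                                         (coincidence S λ w → v≗v' w ∘ ∈F-βʳ R S)
  coincidence (ƛ y R S) {c} {v} {v'} v≗v' =
    graph-cong (coincidence R λ w → v≗v' w ∘ ∈F-ƛˡ y R S) λ r → coincidence S λ w w∈S →
      update-agree (c , v) (c , v') y r w (v≗v' w ∘ ∈F-ƛʳ y R S w∈S)

  ⟦⟧-update-∉F : ∀ {x} T ν s → x ∉F T → ⟦ T ⟧ (ν [ x ≔ s ]) ≡ ⟦ T ⟧ ν
  ⟦⟧-update-∉F T ν s x∉T = coincidence T λ w w∈T → update-≢ ν s (∈F-∉F-≢ T w∈T x∉T)

  SubstitutionLemma : ℕ → Set
  SubstitutionLemma n =
    ∀ T x R → size R ≤ n → ∀ ν → ⟦ sub n T x R ⟧ ν ≡ ⟦ R ⟧ (ν [ x ≔ ⟦ T ⟧ ν ])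

  ⟦sub⟧-ƛ-keep : ∀ {n} → SubstitutionLemma n → ∀ T x y R S → size R ≤ n →
                 (∀ w → w ∈F S → w ≢ y → w ≢ x) → ∀ ν →
                 ⟦ ƛ y (sub n T x R) S ⟧ ν ≡ ⟦ ƛ y R S ⟧ (ν [ x ≔ ⟦ T ⟧ ν ])
  ⟦sub⟧-ƛ-keep sub-n T x y R S R≤n x-hidden ν =
    graph-cong (sub-n T x R R≤n ν) λ r → coincidence S λ w w∈S →
      update-agree ν (ν [ x ≔ ⟦ T ⟧ ν ]) y r w λ w≢y → sym (update-≢ ν _ (x-hidden w w∈S w≢y))

  ⟦sub⟧-ƛ-rename : ∀ {n} → SubstitutionLemma n → ∀ T x y z R S → size R ≤ n → size S ≤ n →
                   z ∉F T → z ≢ x → z ≡ y ⊎ z ∉F S → ∀ ν →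
                   ⟦ ƛ z (sub n T x R) (sub n T x (sub n (var z) y S)) ⟧ ν ≡
                   ⟦ ƛ y R S ⟧ (ν [ x ≔ ⟦ T ⟧ ν ])
  ⟦sub⟧-ƛ-rename {n} sub-n T x y z R S R≤n S≤n z∉T z≢x z-fresh ν =
    graph-cong (sub-n T x R R≤n ν) body
    where
    t = ⟦ T ⟧ ν
    w≢z : ∀ {w} → w ∈F S → w ≢ y → w ≢ z
    w≢z w∈S w≢y = [ (λ z≡y → λ { refl → w≢y z≡y }) , ∈F-∉F-≢ S w∈S ] z-fresh
    body : ∀ r → ⟦ sub n T x (sub n (var z) y S) ⟧ (ν [ z ≔ r ]) ≡ ⟦ S ⟧ ((ν [ x ≔ t ]) [ y ≔ r ])
    body r = begin
      ⟦ sub n T x (sub n (var z) y S) ⟧ νz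
        ≡⟨ sub-n T x _ (subst (_≤ n) (sym (size-sub-var n z y S)) S≤n) νz ⟩
      ⟦ sub n (var z) y S ⟧ (νz [ x ≔ ⟦ T ⟧ νz ])
        ≡⟨ cong (λ s → ⟦ sub n (var z) y S ⟧ (νz [ x ≔ s ])) (⟦⟧-update-∉F T ν r z∉T) ⟩
      ⟦ sub n (var z) y S ⟧ (νz [ x ≔ t ])
        ≡⟨ sub-n (var z) y S S≤n _ ⟩
      ⟦ S ⟧ ((νz [ x ≔ t ]) [ y ≔ proj₂ (νz [ x ≔ t ]) z ])
        ≡⟨ cong (λ s → ⟦ S ⟧ ((νz [ x ≔ t ]) [ y ≔ s ]))
             (trans (update-≢ νz t z≢x) (update-≡ ν z r)) ⟩
      ⟦ S ⟧ ((νz [ x ≔ t ]) [ y ≔ r ])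
        ≡⟨ coincidence S (λ w w∈S → update-agree (νz [ x ≔ t ]) (ν [ x ≔ t ]) y r w λ w≢y →
             update-agree νz ν x t w λ _ → update-≢ ν r (w≢z w∈S w≢y)) ⟩
      ⟦ S ⟧ ((ν [ x ≔ t ]) [ y ≔ r ]) ∎
      where νz = ν [ z ≔ r ]

  ⟦sub⟧-ƛ : ∀ {n} → SubstitutionLemma n → ∀ T x y R S → size R ≤ n → size S ≤ n → ∀ ν →
            ⟦ sub (suc n) T x (ƛ y R S) ⟧ ν ≡ ⟦ ƛ y R S ⟧ (ν [ x ≔ ⟦ T ⟧ ν ])
  ⟦sub⟧-ƛ sub-n T x y R S R≤n S≤n ν with y ≡ᵇ x | ≡ᵇ-reflects y x | free x S in x∈?S
  ... | true  | ofʸ refl | _     = ⟦sub⟧-ƛ-keep sub-n T x y R S R≤n (λ _ _ w≢y → w≢y) ν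
  ... | false | ofⁿ _    | false =
    ⟦sub⟧-ƛ-keep sub-n T x y R S R≤n (λ w w∈S _ → ∈F-∉F-≢ S w∈S x∈?S) ν
  ... | false | ofⁿ y≢x  | true with free y T in y∈?T
  ...   | true  = ⟦sub⟧-ƛ-rename sub-n T x y (fresh T S) R S R≤n S≤n (fresh-∉Fˡ T S)
                    (λ { refl → ∈F-∉F-≢ S x∈?S (fresh-∉Fʳ T S) refl }) (inj₂ (fresh-∉Fʳ T S)) ν
  ...   | false = ⟦sub⟧-ƛ-rename sub-n T x y y R S R≤n S≤n y∈?T y≢x (inj₁ refl) ν

  ⟦sub⟧ : ∀ n → SubstitutionLemma n
  ⟦sub⟧ zero    T x (con _)   () ν
  ⟦sub⟧ zero    T x (var _)   () ν
  ⟦sub⟧ zero    T x (ρ _)     () ν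
  ⟦sub⟧ zero    T x (β _ _)   () ν
  ⟦sub⟧ zero    T x (ƛ _ _ _) () ν
  ⟦sub⟧ (suc n) T x (con a)   _  ν = refl
  ⟦sub⟧ (suc n) T x (var y)   _  ν with x ≡ᵇ y | ≡ᵇ-reflects x y
  ... | true  | ofʸ refl = sym (update-≡ ν x _)
  ... | false | ofⁿ x≢y  = sym (update-≢ ν _ (x≢y ∘ sym))
  ⟦sub⟧ (suc n) T x (ρ R) (s≤s R≤n) ν = cong ∏ (⟦sub⟧ n T x R R≤n ν)
  ⟦sub⟧ (suc n) T x (β R S) (s≤s R⊔S≤n) ν =
    cong₂ _﹫_ (⟦sub⟧ n T x R (m⊔n≤o⇒m≤o _ _ R⊔S≤n) ν) (⟦sub⟧ n T x S (m⊔n≤o⇒n≤o _ _ R⊔S≤n) ν)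
  ⟦sub⟧ (suc n) T x (ƛ y R S) (s≤s R⊔S≤n) ν =
    ⟦sub⟧-ƛ (⟦sub⟧ n) T x y R S (m⊔n≤o⇒m≤o _ _ R⊔S≤n) (m⊔n≤o⇒n≤o _ _ R⊔S≤n) ν

  ⟦[/]⟧ : ∀ R T x ν → ⟦ R [ T / x ] ⟧ ν ≡ ⟦ R ⟧ (ν [ x ≔ ⟦ T ⟧ ν ])
  ⟦[/]⟧ R T x = ⟦sub⟧ (size R) T x R ≤-refl

  ⟦⟧-α-step : ∀ {A B} → α-step A B → ∀ ν → ⟦ A ⟧ ν ≡ ⟦ B ⟧ ν
  ⟦⟧-α-step (rename x y R S _ y∉V) ν = graph-cong refl λ r → sym (begin
      ⟦ S [ var y / x ] ⟧ (ν [ y ≔ r ])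
        ≡⟨ ⟦[/]⟧ S (var y) x _ ⟩
      ⟦ S ⟧ ((ν [ y ≔ r ]) [ x ≔ proj₂ (ν [ y ≔ r ]) y ])
        ≡⟨ cong (λ s → ⟦ S ⟧ ((ν [ y ≔ r ]) [ x ≔ s ])) (update-≡ ν y r) ⟩
      ⟦ S ⟧ ((ν [ y ≔ r ]) [ x ≔ r ])
        ≡⟨ coincidence S (λ w w∈S → update-agree (ν [ y ≔ r ]) ν x r w λ _ →
             update-≢ ν r (∈F-∉F-≢ S w∈S (∨-conicalˡ _ _ y∉V))) ⟩
      ⟦ S ⟧ (ν [ x ≔ r ]) ∎)
  ⟦⟧-α-step (ρ-cong  s)     ν = cong ∏ (⟦⟧-α-step s ν)
  ⟦⟧-α-step (βˡ-cong s)     ν = cong (_﹫ _) (⟦⟧-α-step s ν)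
  ⟦⟧-α-step (βʳ-cong s)     ν = cong (_ ﹫_) (⟦⟧-α-step s ν)
  ⟦⟧-α-step (ƛˡ-cong s)     ν = graph-cong (⟦⟧-α-step s ν) λ _ → refl
  ⟦⟧-α-step (ƛʳ-cong {x} s) ν = graph-cong refl λ r → ⟦⟧-α-step s (ν [ x ≔ r ])

  ⟦⟧-≡α : ∀ {A B} → A ≡α B → ∀ ν → ⟦ A ⟧ ν ≡ ⟦ B ⟧ ν
  ⟦⟧-≡α ε        ν = refl
  ⟦⟧-≡α (s ◅ ss) ν = trans (⟦⟧-α-step s ν) (⟦⟧-≡α ss ν)

  ⊢-sound : ∀ {Γ X} → Γ ⊢ X → Γ ⊨ X
  ⊢-sound (hyp (Y , Y∈Γ , S≡αS' , P≡αP')) ν ν⊨Γ =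
    subst₂ _∈_ (sym (⟦⟧-≡α S≡αS' ν)) (sym (⟦⟧-≡α P≡αP' ν)) (ν⊨Γ Y Y∈Γ)
  ⊢-sound (cut Δ Γ⊢Δ Δ⊢X) ν ν⊨Γ = ⊢-sound Δ⊢X ν λ Y Y∈Δ → ⊢-sound (Γ⊢Δ Y Y∈Δ) ν ν⊨Γ
  ⊢-sound (app F x P R S) ν ν⊨Γ =
    subst (⟦ β F S ⟧ ν ∈_) (sym (⟦[/]⟧ R S x ν)) (∏-graph-﹫ (ν⊨Γ _ (inj₁ refl)) (ν⊨Γ _ (inj₂ refl)))
  ⊢-sound {Γ} (lam x Q S P x∉Γ x∉Q Γ,x:Q⊢S:P) ν ν⊨Γ =
    graph-∈-∏-graph λ q q∈Q → ⊢-sound Γ,x:Q⊢S:P (ν [ x ≔ q ]) (extended q q∈Q)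
    where
    extended : ∀ q → q ∈ ⟦ Q ⟧ ν → ∀ Y → (Γ ∪｛ (var x , Q) ｝) Y → Satisfies (ν [ x ≔ q ]) Y
    extended q q∈Q (A , B) (inj₁ Y∈Γ) =
      subst₂ _∈_ (sym (⟦⟧-update-∉F A ν q (proj₁ (x∉Γ _ Y∈Γ))))
                 (sym (⟦⟧-update-∉F B ν q (proj₂ (x∉Γ _ Y∈Γ)))) (ν⊨Γ _ Y∈Γ)
    extended q q∈Q _ (inj₂ refl) =
      subst₂ _∈_ (sym (update-≡ ν x q)) (sym (⟦⟧-update-∉F Q ν q x∉Q)) q∈Q

proposition8p2 : (M : ZF) (Γ : StmtSet) (X : Stmt) → Γ ⊢ X → Semantics._⊨_ M Γ X
proposition8p2 M Γ X = Soundness.⊢-sound M
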